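{- (Parameterized Deduction Theorem.) Let $\varepsilon,\varepsilon'$ be positive rationals, $\phi\in\mathcal L^+$ and $\psi\in\mathcal L$. 1. If $\vdash_{\varepsilon'+\varepsilon}(\phi\to\psi)$ and $\vdash_{\varepsilon'}\phi$, then $\vdash_{\varepsilon'+\varepsilon}\psi$. 2. If $\vdash_{\varepsilon'+\varepsilon}(\neg\psi\to\neg\phi)$ and $\vdash_{\varepsilon'}\phi$, then $\vdash_{\varepsilon'+\varepsilon}\psi$.
   Context: Formulae $\mathcal L$: $\phi::=\top\mid\neg\phi\mid\phi\land\phi\mid L_r\phi$, $r$ a nonnegative rational; other Boolean connectives are abbreviations, $\bot=\neg\top$. $\mathcal L^+$ is the sublanguage generated by $\psi::=\top\mid\psi\land\psi\mid\psi\lor\psi\mid L_r\psi$. $\varepsilon$-provability ($\varepsilon\ge 0$ rational): $\vdash_\varepsilon$ is the proof system consisting of classical propositional logic together with, for all $\phi,\psi\in\mathcal L$ and nonnegative rationals $r,s$: (A1) $L_\varepsilon\phi$; (A2) $L_{r+s}\phi\to L_r\phi$; (A3) $L_r(\phi\land\psi)\land L_s(\phi\land\neg\psi)\to L_{r+s-\varepsilon}\phi$; (A4) $\neg L_r(\phi\land\psi)\land\neg L_s(\phi\land\neg\psi)\to\neg L_{r+s-\varepsilon}\phi$; (R1) from $\vdash_\varepsilon\phi\to\psi$ infer $\vdash_\varepsilon L_r\phi\to L_r\psi$; (R2) from all of $\{L_r\phi\mid r<s\}$ infer $L_s\phi$; (R3) from all of $\{L_r\phi\mid r>s\}$ infer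 $\bot$. $\vdash_\varepsilon\phi$ means $\phi$ is derivable. -}

module Defs where

open import Data.Bool using (Bool; true; false; not; _∧_)
open import Data.Rational using (ℚ; NonNegative; Positive; _+_; _-_; _<_; _>_)
open import Relation.Binary.PropositionalEquality using (_≡_)

infixr 6 _∧′_
data Formula : Set where
  ⊤′  : Formula
  ¬′_ : Formula → Formula
  _∧′_ : Formula → Formula → Formula
  L   : (r : ℚ) → .{{NonNegative r}} → Formula → Formula

⊥′ : Formula
⊥′ = ¬′ ⊤′

_∨′_ : Formula → Formula → Formula
φ ∨′ ψ = ¬′ ((¬′ φ) ∧′ (¬′ ψ))

_⇒_ : Formula → Formula → Formula
φ ⇒ ψ = ¬′ (φ ∧′ (¬′ ψ))

data IsPos : Formula → Set where
  pos-⊤ : IsPos ⊤′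
  pos-∧ : ∀ {φ ψ} → IsPos φ → IsPos ψ → IsPos (φ ∧′ ψ)
  pos-∨ : ∀ {φ ψ} → IsPos φ → IsPos ψ → IsPos (φ ∨′ ψ)
  pos-L : ∀ r .{{_ : NonNegative r}} {φ} → IsPos φ → IsPos (L r φ)

-- Classical propositional logic: formulas L_r φ are the propositional atoms.
eval : (Formula → Bool) → Formula → Bool
eval v ⊤′ = true
eval v (¬′ φ) = not (eval v φ)
eval v (φ ∧′ ψ) = eval v φ ∧ eval v ψ
eval v (L r φ) = v (L r φ)

Tautology : Formula → Set
Tautology φ = (v : Formula → Bool) → eval v φ ≡ true

-- ε-provability  ε ⊢ φ  (ε a nonnegative rational).
-- Axiom instances are taken only when every index occurring is a
-- nonnegative rational (i.e. when the instance is a formula of 𝓛).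
infix 4 _⊢_
data _⊢_ (ε : ℚ) .{{_ : NonNegative ε}} : Formula → Set where
  taut : ∀ {φ} → Tautology φ → ε ⊢ φ
  mp   : ∀ {φ ψ} → ε ⊢ (φ ⇒ ψ) → ε ⊢ φ → ε ⊢ ψ
  A1   : ∀ φ → ε ⊢ L ε φ
  A2   : ∀ φ r s .{{_ : NonNegative r}} .{{_ : NonNegative s}}
           .{{_ : NonNegative (r + s)}} →
         ε ⊢ (L (r + s) φ ⇒ L r φ)
  A3   : ∀ φ ψ r s .{{_ : NonNegative r}} .{{_ : NonNegative s}}
           .{{_ : NonNegative (r + s - ε)}} →
         ε ⊢ ((L r (φ ∧′ ψ) ∧′ L s (φ ∧′ (¬′ ψ))) ⇒ L (r + s - ε) φ)
  A4   : ∀ φ ψ r s .{{_ : NonNegative r}} .{{_ : NonNegative s}}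
           .{{_ : NonNegative (r + s - ε)}} →
         ε ⊢ (((¬′ L r (φ ∧′ ψ)) ∧′ (¬′ L s (φ ∧′ (¬′ ψ)))) ⇒ (¬′ L (r + s - ε) φ))
  R1   : ∀ {φ ψ} r .{{_ : NonNegative r}} →
         ε ⊢ (φ ⇒ ψ) → ε ⊢ (L r φ ⇒ L r ψ)
  R2   : ∀ {φ} s .{{_ : NonNegative s}} →
         ((r : ℚ) .{{_ : NonNegative r}} → r < s → ε ⊢ L r φ) →
         ε ⊢ L s φ
  R3   : ∀ {φ} s .{{_ : NonNegative s}} →
         ((r : ℚ) .{{_ : NonNegative r}} → r > s → ε ⊢ L r φ) →
         ε ⊢ ⊥′

module Submission where

-- Raising every index r in a derivation to r + e turns a d-derivation into a
-- (d + e)-derivation: the axioms A1–A4 become instances of the same axioms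
-- at level d + e, the slack −d in A3/A4 absorbing one of the three added e's,
-- and R2/R3 are re-indexed (for R2, the new indices below e are covered by
-- A1 + A2 outright).  For positive φ the shifted formula implies φ, since
-- L_{r+e} ψ → L_r ψ by A2 and positive formulae are monotone.  So a positive
-- ε′-theorem is an (ε′ + ε)-theorem, and both parts follow by modus ponens.

open import Data.Bool using (Bool; true; false; not; _∧_)
open import Data.Product using (_×_; _,_)
open import Data.Rational
  using (ℚ; Positive; NonNegative; _+_; _-_; -_; _<_; _>_; _≤_; nonNegative)
open import Data.Rational.Properties
  using ( pos⇒nonNeg; nonNeg+nonNeg⇒nonNeg; nonNegative⁻¹
        ; +-monoˡ-<; +-monoˡ-≤; +-identityˡ; +-inverseʳ
        ; ≤-trans; <⇒≤; ≰⇒>; _≤?_ )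
open import Data.Rational.Solver using (module +-*-Solver)
open import Function using (_∘_)
open import Relation.Binary.PropositionalEquality
  using (_≡_; refl; sym; trans; cong; cong₂; subst)
open import Relation.Nullary using (yes; no)

open import Defs

open +-*-Solver

p+[q-p]≡q : ∀ p q → p + (q - p) ≡ q
p+[q-p]≡q = solve 2 (λ p q → p :+ (q :- p) := q) refl

p-q+q≡p : ∀ p q → (p - q) + q ≡ p
p-q+q≡p = solve 2 (λ p q → (p :- q) :+ q := p) refl

p+q-q≡p : ∀ p q → (p + q) - q ≡ p
p+q-q≡p = solve 2 (λ p q → (p :+ q) :- q := p) refl

p+r+q≡p+q+r : ∀ p q r → (p + r) + q ≡ (p + q) + r
p+r+q≡p+q+r = solve 3 (λ p q r → (p :+ r) :+ q := (p :+ q) :+ r) refl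

p+r+[q+r]-[s+r]≡p+q-s+r : ∀ p q r s → (p + r) + (q + r) - (s + r) ≡ (p + q - s) + r
p+r+[q+r]-[s+r]≡p+q-s+r =
  solve 4 (λ p q r s → (p :+ r) :+ (q :+ r) :- (s :+ r) := (p :+ q :- s) :+ r) refl

p≤q⇒nonNeg[q-p] : ∀ {p q} → p ≤ q → NonNegative (q - p)
p≤q⇒nonNeg[q-p] {p} {q} p≤q =
  nonNegative (subst (_≤ q - p) (+-inverseʳ p) (+-monoˡ-≤ (- p) p≤q))

p<q+r⇒p-r<q : ∀ {p q} r → p < q + r → p - r < q
p<q+r⇒p-r<q {q = q} r p<q+r = subst (_ <_) (p+q-q≡p q r) (+-monoˡ-< (- r) p<q+r)

q+r<p⇒q<p-r : ∀ {p q} r → q + r < p → q < p - r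
q+r<p⇒q<p-r {q = q} r q+r<p = subst (_< _) (p+q-q≡p q r) (+-monoˡ-< (- r) q+r<p)

L-cong : ∀ {r s φ} .⦃ s≥0 : NonNegative s ⦄ (r≡s : r ≡ s) →
         L r ⦃ subst NonNegative (sym r≡s) s≥0 ⦄ φ ≡ L s φ
L-cong refl = refl

infixr 5 _⇒ᵇ_
_⇒ᵇ_ : Bool → Bool → Bool
a ⇒ᵇ b = not (a ∧ not b)

⇒ᵇ-trans : ∀ a b c → (a ⇒ᵇ b) ⇒ᵇ (b ⇒ᵇ c) ⇒ᵇ (a ⇒ᵇ c) ≡ true
⇒ᵇ-trans true  true  true  = refl
⇒ᵇ-trans true  true  false = refl
⇒ᵇ-trans true  false c     = refl
⇒ᵇ-trans false true  true  = refl
⇒ᵇ-trans false true  false = refl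
⇒ᵇ-trans false false true  = refl
⇒ᵇ-trans false false false = refl

∧-mono-⇒ᵇ : ∀ a b c d → (a ⇒ᵇ b) ⇒ᵇ (c ⇒ᵇ d) ⇒ᵇ (a ∧ c ⇒ᵇ b ∧ d) ≡ true
∧-mono-⇒ᵇ true  false c     d     = refl
∧-mono-⇒ᵇ true  true  true  true  = refl
∧-mono-⇒ᵇ true  true  true  false = refl
∧-mono-⇒ᵇ true  true  false d     = refl
∧-mono-⇒ᵇ false b     true  true  = refl
∧-mono-⇒ᵇ false b     true  false = refl
∧-mono-⇒ᵇ false b     false d     = refl

contraposition-⇒ᵇ : ∀ a b → (not b ⇒ᵇ not a) ⇒ᵇ (a ⇒ᵇ b) ≡ true
contraposition-⇒ᵇ true  true  = refl
contraposition-⇒ᵇ true  false = refl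
contraposition-⇒ᵇ false true  = refl
contraposition-⇒ᵇ false false = refl

contraposition⁻-⇒ᵇ : ∀ a b → (a ⇒ᵇ b) ⇒ᵇ (not b ⇒ᵇ not a) ≡ true
contraposition⁻-⇒ᵇ true  true  = refl
contraposition⁻-⇒ᵇ true  false = refl
contraposition⁻-⇒ᵇ false true  = refl
contraposition⁻-⇒ᵇ false false = refl

module _ {δ : ℚ} .⦃ _ : NonNegative δ ⦄ where

  ⇒-trans : ∀ {φ ψ χ} → δ ⊢ (φ ⇒ ψ) → δ ⊢ (ψ ⇒ χ) → δ ⊢ (φ ⇒ χ)
  ⇒-trans {φ} {ψ} {χ} =
    mp ∘ mp (taut λ v → ⇒ᵇ-trans (eval v φ) (eval v ψ) (eval v χ))

  ∧-mono : ∀ {φ φ′ ψ ψ′} → δ ⊢ (φ ⇒ φ′) → δ ⊢ (ψ ⇒ ψ′) → δ ⊢ ((φ ∧′ ψ) ⇒ (φ′ ∧′ ψ′))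
  ∧-mono {φ} {φ′} {ψ} {ψ′} =
    mp ∘ mp (taut λ v → ∧-mono-⇒ᵇ (eval v φ) (eval v φ′) (eval v ψ) (eval v ψ′))

  contraposition : ∀ {φ ψ} → δ ⊢ ((¬′ ψ) ⇒ (¬′ φ)) → δ ⊢ (φ ⇒ ψ)
  contraposition {φ} {ψ} = mp (taut λ v → contraposition-⇒ᵇ (eval v φ) (eval v ψ))

  contraposition⁻ : ∀ {φ ψ} → δ ⊢ (φ ⇒ ψ) → δ ⊢ ((¬′ ψ) ⇒ (¬′ φ))
  contraposition⁻ {φ} {ψ} = mp (taut λ v → contraposition⁻-⇒ᵇ (eval v φ) (eval v ψ))

  ∨-mono : ∀ {φ φ′ ψ ψ′} → δ ⊢ (φ ⇒ φ′) → δ ⊢ (ψ ⇒ ψ′) → δ ⊢ ((φ ∨′ ψ) ⇒ (φ′ ∨′ ψ′))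
  ∨-mono φ⇒φ′ ψ⇒ψ′ =
    contraposition⁻ (∧-mono (contraposition⁻ φ⇒φ′) (contraposition⁻ ψ⇒ψ′))

  ⇒-congʳ : ∀ {χ φ ψ} → φ ≡ ψ → δ ⊢ (χ ⇒ φ) → δ ⊢ (χ ⇒ ψ)
  ⇒-congʳ refl ⊢χ⇒φ = ⊢χ⇒φ

  ⇒-congˡ : ∀ {χ φ ψ} → φ ≡ ψ → δ ⊢ (φ ⇒ χ) → δ ⊢ (ψ ⇒ χ)
  ⇒-congˡ refl ⊢φ⇒χ = ⊢φ⇒χ

  L-≤ : ∀ {r} .⦃ _ : NonNegative r ⦄ φ → r ≤ δ → δ ⊢ L r φ
  L-≤ {r} φ r≤δ = mp (⇒-congˡ (L-cong (p+[q-p]≡q r δ)) A2-upto-δ) (A1 φ)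
    where
    instance
      _ : NonNegative (δ - r)
      _ = p≤q⇒nonNeg[q-p] r≤δ
      _ : NonNegative (r + (δ - r))
      _ = nonNeg+nonNeg⇒nonNeg r (δ - r)
    A2-upto-δ : δ ⊢ (L (r + (δ - r)) φ ⇒ L r φ)
    A2-upto-δ = A2 φ r (δ - r)

module Shift (e : ℚ) .⦃ nonNeg-e : NonNegative e ⦄ where

  nonNeg[+e] : ∀ r .⦃ _ : NonNegative r ⦄ → NonNegative (r + e)
  nonNeg[+e] r = nonNeg+nonNeg⇒nonNeg r e

  shift : Formula → Formula
  shift ⊤′       = ⊤′
  shift (¬′ φ)   = ¬′ shift φ
  shift (φ ∧′ ψ) = shift φ ∧′ shift ψ
  shift (L r φ)  = L (r + e) ⦃ nonNeg[+e] r ⦄ (shift φ)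

  eval-shift : ∀ v φ → eval v (shift φ) ≡ eval (v ∘ shift) φ
  eval-shift v ⊤′       = refl
  eval-shift v (¬′ φ)   = cong not (eval-shift v φ)
  eval-shift v (φ ∧′ ψ) = cong₂ _∧_ (eval-shift v φ) (eval-shift v ψ)
  eval-shift v (L r φ)  = refl

  shift-tautology : ∀ {φ} → Tautology φ → Tautology (shift φ)
  shift-tautology {φ} ⊨φ v = trans (eval-shift v φ) (⊨φ (v ∘ shift))

  shift-⇒ : ∀ {δ} .⦃ _ : NonNegative δ ⦄ {φ} → IsPos φ → δ ⊢ (shift φ ⇒ φ)
  shift-⇒ pos-⊤         = taut λ _ → refl
  shift-⇒ (pos-∧ pφ pψ) = ∧-mono (shift-⇒ pφ) (shift-⇒ pψ)
  shift-⇒ (pos-∨ pφ pψ) = ∨-mono (shift-⇒ pφ) (shift-⇒ pψ)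
  shift-⇒ (pos-L r {φ} pφ) =
    ⇒-trans (R1 (r + e) ⦃ nonNeg[+e] r ⦄ (shift-⇒ pφ))
            (A2 φ r e ⦃ _ ⦄ ⦃ nonNeg-e ⦄ ⦃ nonNeg[+e] r ⦄)

  module _ {d : ℚ} .⦃ _ : NonNegative d ⦄ where

    instance
      nonNeg[d+e] : NonNegative (d + e)
      nonNeg[d+e] = nonNeg[+e] d

    shift-R2 : ∀ {φ} s .⦃ _ : NonNegative s ⦄ →
               ((r : ℚ) .⦃ _ : NonNegative r ⦄ → r < s → (d + e) ⊢ shift (L r φ)) →
               (d + e) ⊢ shift (L s φ)
    shift-R2 {φ} s below = R2 (s + e) ⦃ nonNeg[+e] s ⦄ below′
      where
      below′ : (r : ℚ) .⦃ _ : NonNegative r ⦄ → r < s + e → (d + e) ⊢ L r (shift φ)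
      below′ r r<s+e with e ≤? r
      ... | yes e≤r = subst ((d + e) ⊢_) (L-cong (p-q+q≡p r e))
                        (below (r - e) ⦃ p≤q⇒nonNeg[q-p] e≤r ⦄ (p<q+r⇒p-r<q e r<s+e))
      ... | no  e≰r = L-≤ (shift φ) (≤-trans (<⇒≤ (≰⇒> e≰r)) e≤d+e)
        where
        e≤d+e : e ≤ d + e
        e≤d+e = subst (_≤ d + e) (+-identityˡ e) (+-monoˡ-≤ e (nonNegative⁻¹ d))

    shift-R3 : ∀ {φ} s .⦃ _ : NonNegative s ⦄ →
               ((r : ℚ) .⦃ _ : NonNegative r ⦄ → r > s → (d + e) ⊢ shift (L r φ)) →
               (d + e) ⊢ ⊥′
    shift-R3 {φ} s above = R3 (s + e) ⦃ nonNeg[+e] s ⦄ above′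
      where
      above′ : (r : ℚ) .⦃ _ : NonNegative r ⦄ → r > s + e → (d + e) ⊢ L r (shift φ)
      above′ r s+e<r = subst ((d + e) ⊢_) (L-cong (p-q+q≡p r e))
                         (above (r - e) ⦃ r-e≥0 ⦄ s<r-e)
        where
        s<r-e : s < r - e
        s<r-e = q+r<p⇒q<p-r e s+e<r
        r-e≥0 : NonNegative (r - e)
        r-e≥0 = nonNegative (≤-trans (nonNegative⁻¹ s) (<⇒≤ s<r-e))

    shift-A2 : ∀ φ r s .⦃ _ : NonNegative r ⦄ .⦃ _ : NonNegative s ⦄
               .⦃ _ : NonNegative (r + s) ⦄ →
               (d + e) ⊢ shift (L (r + s) φ ⇒ L r φ)
    shift-A2 φ r s ⦃ _ ⦄ ⦃ s≥0 ⦄ =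
      ⇒-congˡ (L-cong ⦃ nonNeg[+e] (r + s) ⦄ (p+r+q≡p+q+r r s e))
              (A2 (shift φ) (r + e) s ⦃ nonNeg[+e] r ⦄ ⦃ s≥0 ⦄
                  ⦃ nonNeg+nonNeg⇒nonNeg (r + e) ⦃ nonNeg[+e] r ⦄ s ⦄)

    shift-A3 : ∀ φ ψ r s .⦃ _ : NonNegative r ⦄ .⦃ _ : NonNegative s ⦄
               .⦃ _ : NonNegative (r + s - d) ⦄ →
               (d + e) ⊢ shift ((L r (φ ∧′ ψ) ∧′ L s (φ ∧′ (¬′ ψ))) ⇒ L (r + s - d) φ)
    shift-A3 φ ψ r s =
      ⇒-congʳ (L-cong ⦃ nonNeg[+e] (r + s - d) ⦄ index)
              (A3 (shift φ) (shift ψ) (r + e) (s + e) ⦃ nonNeg[+e] r ⦄ ⦃ nonNeg[+e] s ⦄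
                  ⦃ subst NonNegative (sym index) (nonNeg[+e] (r + s - d)) ⦄)
      where
      index : (r + e) + (s + e) - (d + e) ≡ (r + s - d) + e
      index = p+r+[q+r]-[s+r]≡p+q-s+r r s e d

    shift-A4 : ∀ φ ψ r s .⦃ _ : NonNegative r ⦄ .⦃ _ : NonNegative s ⦄
               .⦃ _ : NonNegative (r + s - d) ⦄ →
               (d + e) ⊢ shift (((¬′ L r (φ ∧′ ψ)) ∧′ (¬′ L s (φ ∧′ (¬′ ψ)))) ⇒ (¬′ L (r + s - d) φ))
    shift-A4 φ ψ r s =
      ⇒-congʳ (cong ¬′_ (L-cong ⦃ nonNeg[+e] (r + s - d) ⦄ index))
              (A4 (shift φ) (shift ψ) (r + e) (s + e) ⦃ nonNeg[+e] r ⦄ ⦃ nonNeg[+e] s ⦄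
                  ⦃ subst NonNegative (sym index) (nonNeg[+e] (r + s - d)) ⦄)
      where
      index : (r + e) + (s + e) - (d + e) ≡ (r + s - d) + e
      index = p+r+[q+r]-[s+r]≡p+q-s+r r s e d

    shift-⊢ : ∀ {χ} → d ⊢ χ → (d + e) ⊢ shift χ
    shift-⊢ {χ} (taut ⊨χ)       = taut (shift-tautology {χ} ⊨χ)
    shift-⊢ (mp ⊢φ⇒ψ ⊢φ)        = mp (shift-⊢ ⊢φ⇒ψ) (shift-⊢ ⊢φ)
    shift-⊢ (A1 φ)              = A1 (shift φ)
    shift-⊢ (A2 φ r s)          = shift-A2 φ r s
    shift-⊢ (A3 φ ψ r s)        = shift-A3 φ ψ r s
    shift-⊢ (A4 φ ψ r s)        = shift-A4 φ ψ r s
    shift-⊢ (R1 r ⊢φ⇒ψ)         = R1 (r + e) ⦃ nonNeg[+e] r ⦄ (shift-⊢ ⊢φ⇒ψ)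
    shift-⊢ (R2 s ⦃ s≥0 ⦄ below) =
      shift-R2 s ⦃ s≥0 ⦄ λ r ⦃ r≥0 ⦄ r<s → shift-⊢ (below r ⦃ r≥0 ⦄ r<s)
    shift-⊢ (R3 s ⦃ s≥0 ⦄ above) =
      shift-R3 s ⦃ s≥0 ⦄ λ r ⦃ r≥0 ⦄ r>s → shift-⊢ (above r ⦃ r≥0 ⦄ r>s)

IsPos⇒⊢-mono : ∀ d e .⦃ _ : NonNegative d ⦄ .⦃ _ : NonNegative e ⦄
               .⦃ _ : NonNegative (d + e) ⦄ {φ} →
               IsPos φ → d ⊢ φ → (d + e) ⊢ φ
IsPos⇒⊢-mono d e ⦃ d≥0 ⦄ ⦃ e≥0 ⦄ pos-φ ⊢φ = mp (shift-⇒ pos-φ) (shift-⊢ ⊢φ)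
  where open Shift e ⦃ e≥0 ⦄

theorem4 : (ε ε′ : ℚ) .{{_ : Positive ε}} .{{_ : Positive ε′}}
    .{{_ : NonNegative (ε′ + ε)}}
    (φ ψ : Formula) → IsPos φ →
    ((_⊢_ (ε′ + ε) (φ ⇒ ψ) → _⊢_ ε′ {{pos⇒nonNeg ε′}} φ → _⊢_ (ε′ + ε) ψ)
    × (_⊢_ (ε′ + ε) ((¬′ ψ) ⇒ (¬′ φ)) → _⊢_ ε′ {{pos⇒nonNeg ε′}} φ → _⊢_ (ε′ + ε) ψ))
theorem4 ε ε′ φ ψ pos-φ = detach , λ ⊢¬ψ⇒¬φ → detach (contraposition ⊢¬ψ⇒¬φ)
  where
  detach : (ε′ + ε) ⊢ (φ ⇒ ψ) → _⊢_ ε′ ⦃ pos⇒nonNeg ε′ ⦄ φ → (ε′ + ε) ⊢ ψ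
  detach ⊢φ⇒ψ ⊢φ =
    mp ⊢φ⇒ψ (IsPos⇒⊢-mono ε′ ε ⦃ pos⇒nonNeg ε′ ⦄ ⦃ pos⇒nonNeg ε ⦄ pos-φ ⊢φ)
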